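{- Let $X$ be the Coxeter graph of type $F_n$: a straight line with vertices $s_1,\dots,s_n$, $s_i,s_j$ adjacent iff $|i-j|=1$, $m(s_2,s_3)=4$ and $m(s_i,s_{i+1})=3$ otherwise. Let $w\in W(X)$ be fully commutative. (i) If $w$ has a reduced expression $\mathbf{x}s_3\mathbf{y}s_3\mathbf{z}$ where $s_3,s_4$ do not occur in $\mathbf{y}$, then $\mathbf{y}$ contains exactly one occurrence of $s_2$. Moreover, $w$ has no reduced expression of any of the following forms: (ii) $\mathbf{x}(s_1s_2)\mathbf{y}(s_3s_2s_1s_3)\mathbf{z}$ with $s_3,s_4$ not occurring in $\mathbf{y}$; (iii) $\mathbf{x}(s_4s_3)\mathbf{y}(s_2s_3s_2s_4)\mathbf{z}$ with $s_4,s_5$ not occurring in $\mathbf{y}$; (iv) $\mathbf{x}(s_3s_1s_2s_3)\mathbf{y}(s_2s_1)\mathbf{z}$ with $s_3,s_4$ not occurring in $\mathbf{y}$; (v) $\mathbf{x}(s_4s_2s_3s_2)\mathbf{y}(s_3s_4)\mathbf{z}$ with $s_4,s_5$ not occurring in $\mathbf{y}$.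
   Context: An element is fully commutative if any two of its reduced expressions are related by repeatedly swapping adjacent commuting generators. Here $\mathbf{x},\mathbf{y},\mathbf{z}$ denote words in the generators. -}

module Defs where

open import Data.Nat using (ℕ; zero; suc; _+_; _≤_; _≡ᵇ_)
open import Data.Bool using (Bool; true; false; if_then_else_; _∧_; _∨_)
open import Data.Fin using (Fin; toℕ) renaming (zero to fz; suc to fs)
open import Data.List using (List; []; _∷_; _++_; length)
open import Data.List.Relation.Unary.All using (All)
open import Data.Product using (_×_)
open import Relation.Binary.PropositionalEquality using (_≡_; _≢_)
open import Relation.Binary.Construct.Closure.ReflexiveTransitive using (Star)
open import Relation.Binary.Construct.Closure.Equivalence using (EqClosure)

-- Generators of the Coxeter system of type F_n are Fin n; the generator
-- with index i : Fin n is s_{toℕ i + 1}.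
Word : ℕ → Set
Word n = List (Fin n)

label : ∀ {n} → Fin n → ℕ
label i = suc (toℕ i)

mF : ℕ → ℕ → ℕ
mF a b =
  if a ≡ᵇ b then 1
  else if ((a ≡ᵇ 2) ∧ (b ≡ᵇ 3)) ∨ ((a ≡ᵇ 3) ∧ (b ≡ᵇ 2)) then 4
  else if (suc a ≡ᵇ b) ∨ (suc b ≡ᵇ a) then 3
  else 2

m : ∀ {n} → Fin n → Fin n → ℕ
m s t = mF (label s) (label t)

alt : ∀ {A : Set} → A → A → ℕ → List A
alt s t zero = []
alt s t (suc k) = s ∷ alt t s k

data Step {n : ℕ} : Word n → Word n → Set where
  cancel : ∀ u v (s : Fin n) → Step (u ++ s ∷ s ∷ v) (u ++ v)
  braid  : ∀ u v (s t : Fin n) →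
           Step (u ++ alt s t (m s t) ++ v) (u ++ alt t s (m s t) ++ v)

_≈W_ : ∀ {n} → Word n → Word n → Set
_≈W_ = EqClosure Step

data CommStep {n : ℕ} : Word n → Word n → Set where
  swap : ∀ u v (s t : Fin n) → m s t ≡ 2 →
         CommStep (u ++ s ∷ t ∷ v) (u ++ t ∷ s ∷ v)

_∼c_ : ∀ {n} → Word n → Word n → Set
_∼c_ = Star CommStep

Reduced : ∀ {n} → Word n → Set
Reduced u = ∀ v → v ≈W u → length u ≤ length v

HasRedExpr : ∀ {n} → Word n → Word n → Set
HasRedExpr w e = Reduced e × (e ≈W w)

FullyCommutative : ∀ {n} → Word n → Set
FullyCommutative w = ∀ u v → HasRedExpr w u → HasRedExpr w v → u ∼c v

NotOcc : ∀ {n} → ℕ → Word n → Set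
NotOcc j y = All (λ g → label g ≢ j) y

countOcc : ∀ {n} → ℕ → Word n → ℕ
countOcc j [] = 0
countOcc j (g ∷ y) = (if label g ≡ᵇ j then 1 else 0) + countOcc j y

s₁ s₂ s₃ s₄ : ∀ {k} → Fin (4 + k)
s₁ = fz
s₂ = fs fz
s₃ = fs (fs fz)
s₄ = fs (fs (fs fz))

-- A reduced word of a fully commutative element, and every word commutation equivalent to it,
-- contains no square ss and no braid factor sts… of length m(s,t) ≥ 3: cancelling a square
-- shortens the word, and applying a braid yields a reduced word with a different projection to
-- {s,t}. This property passes to factors and to reversed words. If y avoids s₃ and s₄, its
-- letters s_i with i ≥ 5 commute with s₁, s₂, s₃ and can be moved out of the factor, leaving a
-- square- and braid-free word in s₁, s₂, i.e. one of ε, s₁, s₂, s₁s₂, s₂s₁; each claim is then a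
-- finite check. In (v) the word y is first cut at its first s₃, and (iii), (iv) are (v), (ii)
-- read backwards.

module Submission where

open import Defs
open import Data.Nat using (ℕ; _+_)
open import Data.List using (List; []; _∷_; _++_)
open import Data.Product using (_×_)
open import Relation.Binary.PropositionalEquality using (_≡_)
open import Relation.Nullary using (¬_)

open import Data.Nat using (zero; suc; _≤_; _<_; s≤s; z≤n; _≡ᵇ_)
open import Data.Nat.Properties using (≤-refl; m≤m+n; ≤-trans; 1+n≢n; 1+n≰n; <⇒≱; +-monoʳ-<; m<n⇒m<1+n; n<1+n)
open import Data.Bool using (true; false; _∧_; _∨_)
open import Data.Bool.Properties using (∨-comm; ∧-comm)
open import Data.Fin using (Fin; _≟_) renaming (zero to fz; suc to fs)
open import Data.List using (length; reverse; filter)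
open import Data.List.Properties
  using (++-assoc; length-++; ++-cancelˡ; ∷-injectiveˡ; reverse-++; reverse-involutive; filter-++; filter-all; filter-accept; filter-reject)
open import Data.List.Relation.Unary.All as All using (All; []; _∷_)
open import Data.List.Relation.Unary.All.Properties using (++⁺; ++⁻ˡ; ¬Any⇒All¬; All¬⇒¬Any; all-filter; filter⁺)
open import Data.List.Relation.Unary.Any.Properties as Any using ()
open import Function using (id; _∘_; _⟨_⟩_)
open import Data.Product using (Σ-syntax; _,_; proj₁; proj₂)
open import Data.Sum using (_⊎_; inj₁; inj₂)
open import Data.Empty using (⊥-elim)
open import Relation.Nullary using (Dec; yes; no)
open import Relation.Nullary.Decidable using (_⊎-dec_)
open import Relation.Unary using (Decidable)
open import Relation.Unary.Properties using (∁?)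
import Data.List.Relation.Unary.First as First
open import Data.List.Relation.Unary.First.Properties using (toView)
open import Relation.Binary.PropositionalEquality using (_≢_; refl; sym; trans; cong; subst; subst₂; module ≡-Reasoning)
open import Relation.Binary.Construct.Closure.ReflexiveTransitive using (ε; _◅_; _◅◅_; gmap)
open import Relation.Binary.Construct.Closure.Symmetric using (fwd; bwd)
open import Relation.Binary.Construct.Closure.Equivalence using (symmetric)

≡ᵇ-sym : ∀ a b → (a ≡ᵇ b) ≡ (b ≡ᵇ a)
≡ᵇ-sym zero    zero    = refl
≡ᵇ-sym zero    (suc b) = refl
≡ᵇ-sym (suc a) zero    = refl
≡ᵇ-sym (suc a) (suc b) = ≡ᵇ-sym a b

≡ᵇ-refl : ∀ a → (a ≡ᵇ a) ≡ true
≡ᵇ-refl zero    = refl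
≡ᵇ-refl (suc a) = ≡ᵇ-refl a

mF-sym : ∀ a b → mF a b ≡ mF b a
mF-sym a b
  rewrite ≡ᵇ-sym a b
        | ∨-comm (suc a ≡ᵇ b) (suc b ≡ᵇ a)
        | ∧-comm (a ≡ᵇ 2) (b ≡ᵇ 3)
        | ∧-comm (a ≡ᵇ 3) (b ≡ᵇ 2)
        | ∨-comm ((b ≡ᵇ 3) ∧ (a ≡ᵇ 2)) ((b ≡ᵇ 2) ∧ (a ≡ᵇ 3)) = refl

mF≤4 : ∀ a b → mF a b ≤ 4
mF≤4 a b with a ≡ᵇ b
... | true = s≤s z≤n
... | false with ((a ≡ᵇ 2) ∧ (b ≡ᵇ 3)) ∨ ((a ≡ᵇ 3) ∧ (b ≡ᵇ 2))
... | true = s≤s (s≤s (s≤s (s≤s z≤n)))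
... | false with (suc a ≡ᵇ b) ∨ (suc b ≡ᵇ a)
... | true = s≤s (s≤s (s≤s z≤n))
... | false = s≤s (s≤s z≤n)

m-sym : ∀ {n} (s t : Fin n) → m s t ≡ m t s
m-sym s t = mF-sym (label s) (label t)

m-diag : ∀ {n} (s : Fin n) → m s s ≡ 1
m-diag s rewrite ≡ᵇ-refl (label s) = refl

braid-length : ∀ {n} (s t : Fin n) → 3 ≤ m s t → m s t ≡ 3 ⊎ m s t ≡ 4
braid-length s t 3≤m with m s t | 3≤m | mF≤4 (label s) (label t)
... | 1 | s≤s () | _
... | 2 | s≤s (s≤s ()) | _
... | 3 | _ | _ = inj₁ refl
... | 4 | _ | _ = inj₂ refl
... | suc (suc (suc (suc (suc _)))) | _ | s≤s (s≤s (s≤s (s≤s ())))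

reverse-++³ : ∀ {A : Set} (p q r : List A) → reverse (p ++ q ++ r) ≡ reverse r ++ reverse q ++ reverse p
reverse-++³ p q r = begin
  reverse (p ++ q ++ r)                 ≡⟨ reverse-++ p (q ++ r) ⟩
  reverse (q ++ r) ++ reverse p         ≡⟨ cong (_++ reverse p) (reverse-++ q r) ⟩
  (reverse r ++ reverse q) ++ reverse p ≡⟨ ++-assoc (reverse r) (reverse q) (reverse p) ⟩
  reverse r ++ reverse q ++ reverse p   ∎
  where open ≡-Reasoning

module _ {n : ℕ} where

  private
    variable
      u v : Word n

  CommStep-++ˡ : ∀ x → CommStep u v → CommStep (x ++ u) (x ++ v)
  CommStep-++ˡ x (swap p r c d e) =
    subst₂ CommStep (++-assoc x p _) (++-assoc x p _) (swap (x ++ p) r c d e)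

  CommStep-++ʳ : ∀ z → CommStep u v → CommStep (u ++ z) (v ++ z)
  CommStep-++ʳ z (swap p r c d e) =
    subst₂ CommStep (sym (++-assoc p _ z)) (sym (++-assoc p _ z)) (swap p (r ++ z) c d e)

  CommStep-reverse : CommStep u v → CommStep (reverse u) (reverse v)
  CommStep-reverse (swap p r c d e) =
    subst₂ CommStep (sym (reverse-++³ p (c ∷ d ∷ []) r)) (sym (reverse-++³ p (d ∷ c ∷ []) r))
      (swap (reverse r) (reverse p) d c (trans (m-sym d c) e))

  ∼c-++ˡ : ∀ x → u ∼c v → (x ++ u) ∼c (x ++ v)
  ∼c-++ˡ x = gmap (x ++_) (CommStep-++ˡ x)

  ∼c-++ʳ : ∀ z → u ∼c v → (u ++ z) ∼c (v ++ z)
  ∼c-++ʳ z = gmap (_++ z) (CommStep-++ʳ z)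

  ∼c-reverse : u ∼c v → reverse u ∼c reverse v
  ∼c-reverse = gmap reverse CommStep-reverse

  ∼c⇒≈W : u ∼c v → u ≈W v
  ∼c⇒≈W = gmap id (λ { (swap p r c d e) →
    fwd (subst (λ k → Step (p ++ alt c d k ++ r) (p ++ alt d c k ++ r)) e (braid p r c d)) })

  ∼c-length : u ∼c v → length u ≡ length v
  ∼c-length ε = refl
  ∼c-length (swap p r c d e ◅ uv) = trans (trans (length-++ p) (sym (length-++ p))) (∼c-length uv)

  commute-past : ∀ A f r → All (λ a → m a f ≡ 2) A → (A ++ f ∷ r) ∼c (f ∷ A ++ r)
  commute-past []      f r []         = ε
  commute-past (a ∷ A) f r (e ∷ A∼f) =
    ∼c-++ˡ (a ∷ []) (commute-past A f r A∼f) ◅◅ swap [] (A ++ r) a f e ◅ ε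

  HasSquare : Word n → Set
  HasSquare v = Σ[ a ∈ Word n ] Σ[ b ∈ Word n ] Σ[ s ∈ Fin n ] v ≡ a ++ s ∷ s ∷ b

  HasBraid : Word n → Set
  HasBraid v = Σ[ a ∈ Word n ] Σ[ b ∈ Word n ] Σ[ s ∈ Fin n ] Σ[ t ∈ Fin n ]
    3 ≤ m s t × v ≡ a ++ alt s t (m s t) ++ b

  FCWord : Word n → Set
  FCWord u = ∀ v → u ∼c v → ¬ HasSquare v × ¬ HasBraid v

  reduced⇒¬HasSquare : Reduced u → u ∼c v → ¬ HasSquare v
  reduced⇒¬HasSquare {u} red uv (a , b , s , refl) = <⇒≱ shorter (red (a ++ b) ab≈u)
    where
    ab≈u : (a ++ b) ≈W u
    ab≈u = bwd (cancel a b s) ◅ symmetric Step (∼c⇒≈W uv)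
    open Data.Nat.Properties.≤-Reasoning
    shorter : length (a ++ b) < length u
    shorter = begin-strict
      length (a ++ b)                   ≡⟨ length-++ a ⟩
      length a + length b               <⟨ +-monoʳ-< (length a) (m<n⇒m<1+n (n<1+n (length b))) ⟩
      length a + length (s ∷ s ∷ b)     ≡⟨ length-++ a ⟨
      length (a ++ s ∷ s ∷ b)           ≡⟨ ∼c-length uv ⟨
      length u                          ∎

  filter-∼c : {P : Fin n → Set} (P? : Decidable P) → (∀ {c d} → P c → P d → m c d ≢ 2) →
    u ∼c v → filter P? u ≡ filter P? v
  filter-∼c P? noncomm ε = refl
  filter-∼c {v = v} {P = P} P? noncomm (swap p r c d e ◅ uv) = begin
    filter P? (p ++ c ∷ d ∷ r)              ≡⟨ filter-++ P? p _ ⟩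
    filter P? p ++ filter P? (c ∷ d ∷ r)    ≡⟨ cong (filter P? p ++_) swap-filtered ⟩
    filter P? p ++ filter P? (d ∷ c ∷ r)    ≡⟨ filter-++ P? p _ ⟨
    filter P? (p ++ d ∷ c ∷ r)              ≡⟨ filter-∼c P? noncomm uv ⟩
    filter P? v                             ∎
    where
    open ≡-Reasoning
    swap-filtered : filter P? (c ∷ d ∷ r) ≡ filter P? (d ∷ c ∷ r)
    swap-filtered = by-cases (P? c) (P? d)
      where
      by-cases : Dec (P c) → Dec (P d) → filter P? (c ∷ d ∷ r) ≡ filter P? (d ∷ c ∷ r)
      by-cases (yes pc) (yes pd) = ⊥-elim (noncomm pc pd e)
      by-cases (yes pc) (no ¬pd) = trans (filter-accept P? pc) (cong (c ∷_) (filter-reject P? ¬pd))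
                             ⟨ trans ⟩ sym (trans (filter-reject P? ¬pd) (filter-accept P? pc))
      by-cases (no ¬pc) (yes pd) = trans (filter-reject P? ¬pc) (filter-accept P? pd)
                             ⟨ trans ⟩ sym (trans (filter-accept P? pd) (cong (d ∷_) (filter-reject P? ¬pc)))
      by-cases (no ¬pc) (no ¬pd) = trans (filter-reject P? ¬pc) (filter-reject P? ¬pd)
                             ⟨ trans ⟩ sym (trans (filter-reject P? ¬pd) (filter-reject P? ¬pc))

  All-alt : ∀ {P : Fin n → Set} {s t} k → P s → P t → All P (alt s t k)
  All-alt zero    ps pt = []
  All-alt (suc k) ps pt = ps ∷ All-alt k pt ps

  length-alt : ∀ (s t : Fin n) k → length (alt s t k) ≡ k
  length-alt s t zero    = refl
  length-alt s t (suc k) = cong suc (length-alt t s k)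

  length-braid : ∀ a b (s t : Fin n) k → length (a ++ alt s t k ++ b) ≡ length (a ++ alt t s k ++ b)
  length-braid a b s t k = begin
    length (a ++ alt s t k ++ b)                ≡⟨ length-++ a ⟩
    length a + length (alt s t k ++ b)          ≡⟨ cong (length a +_) (length-++ (alt s t k)) ⟩
    length a + (length (alt s t k) + length b)  ≡⟨ cong (λ i → length a + (i + length b)) same-length ⟩
    length a + (length (alt t s k) + length b)  ≡⟨ cong (length a +_) (length-++ (alt t s k)) ⟨
    length a + length (alt t s k ++ b)          ≡⟨ length-++ a ⟨
    length (a ++ alt t s k ++ b)                ∎
    where
    open ≡-Reasoning
    same-length : length (alt s t k) ≡ length (alt t s k)
    same-length = trans (length-alt s t k) (sym (length-alt t s k))

  alt-head : ∀ {s t : Fin n} {k X Y} → 1 ≤ k → alt s t k ++ X ≡ alt t s k ++ Y → s ≡ t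
  alt-head {k = suc k} _ = ∷-injectiveˡ

  Reduced-≈W : Reduced u → v ≈W u → length u ≡ length v → Reduced v
  Reduced-≈W u-red v≈u same-length q q≈v = subst (_≤ length q) same-length (u-red q (q≈v ◅◅ v≈u))

  Pair : Fin n → Fin n → Fin n → Set
  Pair s t g = g ≡ s ⊎ g ≡ t

  pair? : ∀ s t → Decidable (Pair s t)
  pair? s t g = (g ≟ s) ⊎-dec (g ≟ t)

  pair-noncommuting : ∀ {s t c d} → 3 ≤ m s t → Pair s t c → Pair s t d → m c d ≢ 2
  pair-noncommuting {s} 3≤m (inj₁ refl) (inj₁ refl) e = 1+n≢n (trans (sym e) (m-diag s))
  pair-noncommuting {t = t} 3≤m (inj₂ refl) (inj₂ refl) e = 1+n≢n (trans (sym e) (m-diag t))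
  pair-noncommuting 3≤m (inj₁ refl) (inj₂ refl) e = 1+n≰n (subst (3 ≤_) e 3≤m)
  pair-noncommuting {s} {t} 3≤m (inj₂ refl) (inj₁ refl) e = 1+n≰n (subst (3 ≤_) (trans (m-sym s t) e) 3≤m)

  filter-pair-around : ∀ {s t} a x b → All (Pair s t) x →
    filter (pair? s t) (a ++ x ++ b) ≡ filter (pair? s t) a ++ x ++ filter (pair? s t) b
  filter-pair-around {s} {t} a x b x⊆st = begin
    filter st? (a ++ x ++ b)                   ≡⟨ filter-++ st? a _ ⟩
    filter st? a ++ filter st? (x ++ b)        ≡⟨ cong (filter st? a ++_) (filter-++ st? x b) ⟩
    filter st? a ++ filter st? x ++ filter st? b ≡⟨ cong (λ x′ → filter st? a ++ x′ ++ filter st? b) (filter-all st? x⊆st) ⟩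
    filter st? a ++ x ++ filter st? b          ∎
    where
    open ≡-Reasoning
    st? = pair? s t

  -- Applying the braid to v gives another reduced expression v′, so u ∼c v′ by full
  -- commutativity; but the projection to {s,t} is a commutation invariant that separates v from v′.
  fc⇒¬HasBraid : ∀ {w} → FullyCommutative w → HasRedExpr w u → u ∼c v → ¬ HasBraid v
  fc⇒¬HasBraid {u = u} fc (u-red , u≈w) uv (a , b , s , t , 3≤m , refl) =
    s≢t (alt-head (≤-trans (s≤s z≤n) 3≤m) (++-cancelˡ (filter st? a) _ _ projections-agree))
    where
    M = m s t
    st? = pair? s t
    v′ = a ++ alt t s M ++ b

    v′≈u : v′ ≈W u
    v′≈u = bwd (braid a b s t) ◅ symmetric Step (∼c⇒≈W uv)

    u∼v′ : u ∼c v′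
    u∼v′ = fc u v′ (u-red , u≈w)
      (Reduced-≈W u-red v′≈u (trans (∼c-length uv) (length-braid a b s t M)) , v′≈u ◅◅ u≈w)

    projections-agree : filter st? a ++ alt s t M ++ filter st? b ≡ filter st? a ++ alt t s M ++ filter st? b
    projections-agree = begin
      filter st? a ++ alt s t M ++ filter st? b ≡⟨ filter-pair-around a _ b (All-alt M (inj₁ refl) (inj₂ refl)) ⟨
      filter st? (a ++ alt s t M ++ b)          ≡⟨ filter-∼c st? (pair-noncommuting 3≤m) uv ⟨
      filter st? u                              ≡⟨ filter-∼c st? (pair-noncommuting 3≤m) u∼v′ ⟩
      filter st? v′                             ≡⟨ filter-pair-around a _ b (All-alt M (inj₂ refl) (inj₁ refl)) ⟩
      filter st? a ++ alt t s M ++ filter st? b ∎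
      where open ≡-Reasoning

    s≢t : s ≢ t
    s≢t refl = <⇒≱ (s≤s (s≤s z≤n)) (subst (3 ≤_) (m-diag s) 3≤m)

  FCWord-redExpr : ∀ {w} → FullyCommutative w → HasRedExpr w u → FCWord u
  FCWord-redExpr fc hr v uv = reduced⇒¬HasSquare (proj₁ hr) uv , fc⇒¬HasBraid fc hr uv

  FCWord⇒¬HasSquare : FCWord u → ¬ HasSquare u
  FCWord⇒¬HasSquare fc = proj₁ (fc _ ε)

  FCWord⇒¬HasBraid : FCWord u → ¬ HasBraid u
  FCWord⇒¬HasBraid fc = proj₂ (fc _ ε)

  FCWord-∼c : FCWord u → u ∼c v → FCWord v
  FCWord-∼c fc uv w vw = fc w (uv ◅◅ vw)

  FCWord-++⁻ʳ : ∀ x → FCWord (x ++ u) → FCWord u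
  FCWord-++⁻ʳ x fc v uv with fc (x ++ v) (∼c-++ˡ x uv)
  ... | ¬sq , ¬br =
    (λ { (a , b , s , refl) → ¬sq (x ++ a , b , s , sym (++-assoc x a _)) }) ,
    (λ { (a , b , s , t , 3≤m , refl) → ¬br (x ++ a , b , s , t , 3≤m , sym (++-assoc x a _)) })

  FCWord-++⁻ˡ : ∀ z → FCWord (u ++ z) → FCWord u
  FCWord-++⁻ˡ z fc v uv with fc (v ++ z) (∼c-++ʳ z uv)
  ... | ¬sq , ¬br =
    (λ { (a , b , s , refl) → ¬sq (a , b ++ z , s , ++-assoc a _ z) }) ,
    (λ { (a , b , s , t , 3≤m , refl) → ¬br (a , b ++ z , s , t , 3≤m ,
           trans (++-assoc a _ z) (cong (a ++_) (++-assoc (alt s t (m s t)) b z))) })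

  FCWord-infix : ∀ x A y Q z → FCWord (x ++ A ++ y ++ Q ++ z) → FCWord (A ++ y ++ Q)
  FCWord-infix x A y Q z fc = FCWord-++⁻ˡ z (subst FCWord reassoc (FCWord-++⁻ʳ x fc))
    where
    reassoc : A ++ y ++ Q ++ z ≡ (A ++ y ++ Q) ++ z
    reassoc = sym (trans (++-assoc A (y ++ Q) z) (cong (A ++_) (++-assoc y Q z)))

  HasSquare-reverse : HasSquare v → HasSquare (reverse v)
  HasSquare-reverse (a , b , s , refl) = reverse b , reverse a , s , reverse-++³ a (s ∷ s ∷ []) b

  reverse-short-alt : ∀ (s t : Fin n) {k} → k ≡ 3 ⊎ k ≡ 4 →
    reverse (alt s t k) ≡ alt s t k ⊎ reverse (alt s t k) ≡ alt t s k
  reverse-short-alt s t (inj₁ refl) = inj₁ refl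
  reverse-short-alt s t (inj₂ refl) = inj₂ refl

  HasBraid-reverse : HasBraid v → HasBraid (reverse v)
  HasBraid-reverse (a , b , s , t , 3≤m , refl) with reverse-short-alt s t (braid-length s t 3≤m)
  ... | inj₁ palindrome = reverse b , reverse a , s , t , 3≤m ,
          trans (reverse-++³ a _ b) (cong (λ x → reverse b ++ x ++ reverse a) palindrome)
  ... | inj₂ reversed = reverse b , reverse a , t , s , subst (3 ≤_) (m-sym s t) 3≤m ,
          trans (reverse-++³ a _ b) (cong (λ x → reverse b ++ x ++ reverse a)
            (trans reversed (cong (alt t s) (m-sym s t))))

  FCWord-reverse : FCWord u → FCWord (reverse u)
  FCWord-reverse {u} fc v ru∼v with fc (reverse v) (subst (_∼c reverse v) (reverse-involutive u) (∼c-reverse ru∼v))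
  ... | ¬sq , ¬br = ¬sq ∘ HasSquare-reverse , ¬br ∘ HasBraid-reverse

  module _ {Low Far : Fin n → Set} (far? : Decidable Far)
           (low-far : ∀ {a f} → Low a → Far f → m a f ≡ 2) where

    separate : ∀ A y Q → All Low A → All (λ g → Far g ⊎ Low g) y →
      (A ++ y ++ Q) ∼c (filter far? y ++ A ++ filter (∁? far?) y ++ Q)
    separate A []      Q lowA [] = ε
    separate A (g ∷ y) Q lowA (far-or-low ∷ rest) with far? g | far-or-low
    ... | yes far-g | _ =
      commute-past A g (y ++ Q) (All.map (λ low-a → low-far low-a far-g) lowA)
        ◅◅ ∼c-++ˡ (g ∷ []) (separate A y Q lowA rest)
    ... | no ¬far-g | inj₁ far-g = ⊥-elim (¬far-g far-g)
    ... | no _      | inj₂ low-g =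
      subst₂ _∼c_ (++-assoc A (g ∷ []) (y ++ Q)) (cong (filter far? y ++_) (++-assoc A (g ∷ []) _))
        (separate (A ++ g ∷ []) y Q (++⁺ lowA (low-g ∷ [])) rest)

  NotOcc-reverse : ∀ {j} {y : Word n} → NotOcc j y → NotOcc j (reverse y)
  NotOcc-reverse {y = y} ¬y = ¬Any⇒All¬ (reverse y) (All¬⇒¬Any ¬y ∘ Any.reverse⁻)

module _ {k : ℕ} where

  private
    W : Set
    W = Word (4 + k)

  data Far : Fin (4 + k) → Set where
    far : ∀ j → Far (fs (fs (fs (fs j))))

  far? : Decidable Far
  far? fz                     = no λ ()
  far? (fs fz)                = no λ ()
  far? (fs (fs fz))           = no λ ()
  far? (fs (fs (fs fz)))      = no λ ()
  far? (fs (fs (fs (fs j))))  = yes (far j)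

  data Near : Fin (4 + k) → Set where
    near₁ : Near s₁
    near₂ : Near s₂

  data Low : Fin (4 + k) → Set where
    low₁ : Low s₁
    low₂ : Low s₂
    low₃ : Low s₃

  Near⇒Low : ∀ {g} → Near g → Low g
  Near⇒Low near₁ = low₁
  Near⇒Low near₂ = low₂

  low-far : ∀ {a f} → Low a → Far f → m a f ≡ 2
  low-far low₁ (far j) = refl
  low-far low₂ (far j) = refl
  low-far low₃ (far j) = refl

  far-or-near : ∀ g → label g ≢ 3 → label g ≢ 4 → Far g ⊎ Near g
  far-or-near fz                    _   _   = inj₂ near₁
  far-or-near (fs fz)               _   _   = inj₂ near₂
  far-or-near (fs (fs fz))          ≢3 _   = ⊥-elim (≢3 refl)
  far-or-near (fs (fs (fs fz)))     _   ≢4 = ⊥-elim (≢4 refl)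
  far-or-near (fs (fs (fs (fs j)))) _   _   = inj₁ (far j)

  all-far-or-near : ∀ {y : W} → NotOcc 3 y → NotOcc 4 y → All (λ g → Far g ⊎ Near g) y
  all-far-or-near ¬3 ¬4 = All.zipWith (λ { {g} (≢3 , ≢4) → far-or-near g ≢3 ≢4 }) (¬3 , ¬4)

  nearPart : W → W
  nearPart = filter (∁? far?)

  nearPart-near : ∀ {y} → NotOcc 3 y → NotOcc 4 y → All Near (nearPart y)
  nearPart-near {y} ¬3 ¬4 = All.zipWith near
    (filter⁺ (∁? far?) (all-far-or-near ¬3 ¬4) , all-filter (∁? far?) y)
    where
    near : ∀ {g} → (Far g ⊎ Near g) × ¬ Far g → Near g
    near (inj₁ far-g  , ¬far-g) = ⊥-elim (¬far-g far-g)
    near (inj₂ near-g , _)      = near-g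

  countOcc₂-nearPart : ∀ y → countOcc 2 (nearPart y) ≡ countOcc 2 y
  countOcc₂-nearPart []      = refl
  countOcc₂-nearPart (g ∷ y) with far? g
  ... | yes (far j) = countOcc₂-nearPart y
  ... | no _        = cong (_ +_) (countOcc₂-nearPart y)

  data Shape : W → Set where
    []     : Shape []
    [s₁]   : Shape (s₁ ∷ [])
    [s₂]   : Shape (s₂ ∷ [])
    [s₁s₂] : Shape (s₁ ∷ s₂ ∷ [])
    [s₂s₁] : Shape (s₂ ∷ s₁ ∷ [])

  near-shape : ∀ {u} → All Near u → ¬ HasSquare u → ¬ HasBraid u → Shape u
  near-shape []                        ¬sq ¬br = []
  near-shape (near₁ ∷ [])              ¬sq ¬br = [s₁]
  near-shape (near₂ ∷ [])              ¬sq ¬br = [s₂]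
  near-shape (near₁ ∷ near₂ ∷ [])      ¬sq ¬br = [s₁s₂]
  near-shape (near₂ ∷ near₁ ∷ [])      ¬sq ¬br = [s₂s₁]
  near-shape (near₁ ∷ near₁ ∷ _)       ¬sq ¬br = ⊥-elim (¬sq ([] , _ , s₁ , refl))
  near-shape (near₂ ∷ near₂ ∷ _)       ¬sq ¬br = ⊥-elim (¬sq ([] , _ , s₂ , refl))
  near-shape (near₁ ∷ near₂ ∷ near₂ ∷ _) ¬sq ¬br = ⊥-elim (¬sq (s₁ ∷ [] , _ , s₂ , refl))
  near-shape (near₂ ∷ near₁ ∷ near₁ ∷ _) ¬sq ¬br = ⊥-elim (¬sq (s₂ ∷ [] , _ , s₁ , refl))
  near-shape (near₁ ∷ near₂ ∷ near₁ ∷ _) ¬sq ¬br = ⊥-elim (¬br ([] , _ , s₁ , s₂ , ≤-refl , refl))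
  near-shape (near₂ ∷ near₁ ∷ near₂ ∷ _) ¬sq ¬br = ⊥-elim (¬br ([] , _ , s₂ , s₁ , ≤-refl , refl))

  strip-far : ∀ A y Q → All Low A → NotOcc 3 y → NotOcc 4 y → FCWord (A ++ y ++ Q) →
    Σ[ u ∈ W ] Shape u × countOcc 2 u ≡ countOcc 2 y × FCWord (A ++ u ++ Q)
  strip-far A y Q lowA ¬3 ¬4 fc =
    nearPart y ,
    near-shape (nearPart-near ¬3 ¬4) (FCWord⇒¬HasSquare fc-near) (FCWord⇒¬HasBraid fc-near) ,
    countOcc₂-nearPart y ,
    fc-stripped
    where
    far-or-low : All (λ g → Far g ⊎ Low g) y
    far-or-low = All.map (Data.Sum.map₂ Near⇒Low) (all-far-or-near ¬3 ¬4)
    fc-stripped : FCWord (A ++ nearPart y ++ Q)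
    fc-stripped = FCWord-++⁻ʳ (filter far? y) (FCWord-∼c fc (separate far? low-far A y Q lowA far-or-low))
    fc-near : FCWord (nearPart y)
    fc-near = FCWord-++⁻ˡ Q (FCWord-++⁻ʳ A fc-stripped)

  shape-count₂-between-s₃ : ∀ {u} → Shape u → FCWord (s₃ ∷ u ++ s₃ ∷ []) → countOcc 2 u ≡ 1
  shape-count₂-between-s₃ []     fc = ⊥-elim (FCWord⇒¬HasSquare fc ([] , [] , s₃ , refl))
  shape-count₂-between-s₃ [s₁]   fc = ⊥-elim (FCWord⇒¬HasSquare (FCWord-∼c fc (swap [] _ s₃ s₁ refl ◅ ε))
                                                (s₁ ∷ [] , [] , s₃ , refl))
  shape-count₂-between-s₃ [s₂]   fc = refl
  shape-count₂-between-s₃ [s₁s₂] fc = refl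
  shape-count₂-between-s₃ [s₂s₁] fc = refl

  shape-¬FCWord-s₁s₂ys₃s₂s₁s₃ : ∀ {u} → Shape u → ¬ FCWord (s₁ ∷ s₂ ∷ u ++ s₃ ∷ s₂ ∷ s₁ ∷ s₃ ∷ [])
  shape-¬FCWord-s₁s₂ys₃s₂s₁s₃ []     fc = FCWord⇒¬HasBraid (FCWord-∼c fc (swap (s₁ ∷ s₂ ∷ s₃ ∷ s₂ ∷ []) [] s₁ s₃ refl ◅ ε))
                                           (s₁ ∷ [] , s₁ ∷ [] , s₂ , s₃ , m≤m+n 3 1 , refl)
  shape-¬FCWord-s₁s₂ys₃s₂s₁s₃ [s₁]   fc = FCWord⇒¬HasBraid fc ([] , _ , s₁ , s₂ , ≤-refl , refl)
  shape-¬FCWord-s₁s₂ys₃s₂s₁s₃ [s₂]   fc = FCWord⇒¬HasSquare fc (s₁ ∷ [] , _ , s₂ , refl)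
  shape-¬FCWord-s₁s₂ys₃s₂s₁s₃ [s₁s₂] fc = FCWord⇒¬HasBraid fc ([] , _ , s₁ , s₂ , ≤-refl , refl)
  shape-¬FCWord-s₁s₂ys₃s₂s₁s₃ [s₂s₁] fc = FCWord⇒¬HasSquare fc (s₁ ∷ [] , _ , s₂ , refl)

  shape-¬FCWord-s₂s₃s₂ys₃ : ∀ {u} → Shape u → ¬ FCWord (s₂ ∷ s₃ ∷ s₂ ∷ u ++ s₃ ∷ [])
  shape-¬FCWord-s₂s₃s₂ys₃ []     fc = FCWord⇒¬HasBraid fc ([] , [] , s₂ , s₃ , m≤m+n 3 1 , refl)
  shape-¬FCWord-s₂s₃s₂ys₃ [s₁]   fc = FCWord⇒¬HasBraid (FCWord-∼c fc (swap (s₂ ∷ s₃ ∷ s₂ ∷ []) [] s₁ s₃ refl ◅ ε))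
                                       ([] , s₁ ∷ [] , s₂ , s₃ , m≤m+n 3 1 , refl)
  shape-¬FCWord-s₂s₃s₂ys₃ [s₂]   fc = FCWord⇒¬HasSquare fc (s₂ ∷ s₃ ∷ [] , _ , s₂ , refl)
  shape-¬FCWord-s₂s₃s₂ys₃ [s₁s₂] fc = FCWord⇒¬HasBraid fc (s₂ ∷ s₃ ∷ [] , _ , s₂ , s₁ , ≤-refl , refl)
  shape-¬FCWord-s₂s₃s₂ys₃ [s₂s₁] fc = FCWord⇒¬HasSquare fc (s₂ ∷ s₃ ∷ [] , _ , s₂ , refl)

  count₂-between-s₃ : ∀ y → NotOcc 3 y → NotOcc 4 y → FCWord (s₃ ∷ y ++ s₃ ∷ []) → countOcc 2 y ≡ 1
  count₂-between-s₃ y ¬3 ¬4 fc with strip-far (s₃ ∷ []) y (s₃ ∷ []) (low₃ ∷ []) ¬3 ¬4 fc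
  ... | u , shape , same-count , fc-u = trans (sym same-count) (shape-count₂-between-s₃ shape fc-u)

  ¬FCWord-s₁s₂ys₃s₂s₁s₃ : ∀ y → NotOcc 3 y → NotOcc 4 y → ¬ FCWord (s₁ ∷ s₂ ∷ y ++ s₃ ∷ s₂ ∷ s₁ ∷ s₃ ∷ [])
  ¬FCWord-s₁s₂ys₃s₂s₁s₃ y ¬3 ¬4 fc with strip-far (s₁ ∷ s₂ ∷ []) y _ (low₁ ∷ low₂ ∷ []) ¬3 ¬4 fc
  ... | u , shape , _ , fc-u = shape-¬FCWord-s₁s₂ys₃s₂s₁s₃ shape fc-u

  ¬FCWord-s₂s₃s₂ys₃-no-s₃ : ∀ y → NotOcc 3 y → NotOcc 4 y → ¬ FCWord (s₂ ∷ s₃ ∷ s₂ ∷ y ++ s₃ ∷ [])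
  ¬FCWord-s₂s₃s₂ys₃-no-s₃ y ¬3 ¬4 fc with strip-far (s₂ ∷ s₃ ∷ s₂ ∷ []) y _ (low₂ ∷ low₃ ∷ low₂ ∷ []) ¬3 ¬4 fc
  ... | u , shape , _ , fc-u = shape-¬FCWord-s₂s₃s₂ys₃ shape fc-u

  s₃-or-not : (g : Fin (4 + k)) → label g ≢ 3 ⊎ g ≡ s₃
  s₃-or-not fz                = inj₁ λ ()
  s₃-or-not (fs fz)           = inj₁ λ ()
  s₃-or-not (fs (fs fz))      = inj₂ refl
  s₃-or-not (fs (fs (fs _)))  = inj₁ λ ()

  ¬FCWord-s₂s₃s₂ys₃ : ∀ y → NotOcc 4 y → ¬ FCWord (s₂ ∷ s₃ ∷ s₂ ∷ y ++ s₃ ∷ [])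
  ¬FCWord-s₂s₃s₂ys₃ y ¬4 fc with First.first {P = λ g → label g ≢ 3} {Q = _≡ s₃ {k}} s₃-or-not y
  ... | inj₂ ¬3 = ¬FCWord-s₂s₃s₂ys₃-no-s₃ y ¬3 ¬4 fc
  ... | inj₁ first-s₃ with toView first-s₃
  ... | First._++_∷_ {xs = a} ¬3 refl b =
    ¬FCWord-s₂s₃s₂ys₃-no-s₃ a ¬3 (++⁻ˡ a ¬4)
      (FCWord-infix [] (s₂ ∷ s₃ ∷ s₂ ∷ []) a (s₃ ∷ []) (b ++ s₃ ∷ [])
        (subst FCWord (cong (λ x → s₂ ∷ s₃ ∷ s₂ ∷ x) (++-assoc a (s₃ ∷ b) (s₃ ∷ []))) fc))

  ¬FCWord-s₃ys₂s₃s₂ : ∀ y → NotOcc 4 y → ¬ FCWord (s₃ ∷ y ++ s₂ ∷ s₃ ∷ s₂ ∷ [])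
  ¬FCWord-s₃ys₂s₃s₂ y ¬4 fc = ¬FCWord-s₂s₃s₂ys₃ (reverse y) (NotOcc-reverse ¬4)
    (subst FCWord (reverse-++³ (s₃ ∷ []) y _) (FCWord-reverse fc))

  ¬FCWord-s₃s₁s₂s₃ys₂s₁ : ∀ y → NotOcc 3 y → NotOcc 4 y → ¬ FCWord (s₃ ∷ s₁ ∷ s₂ ∷ s₃ ∷ y ++ s₂ ∷ s₁ ∷ [])
  ¬FCWord-s₃s₁s₂s₃ys₂s₁ y ¬3 ¬4 fc = ¬FCWord-s₁s₂ys₃s₂s₁s₃ (reverse y) (NotOcc-reverse ¬3) (NotOcc-reverse ¬4)
    (subst FCWord (reverse-++³ (s₃ ∷ s₁ ∷ s₂ ∷ s₃ ∷ []) y _) (FCWord-reverse fc))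

lemma4p3p3 : (k : ℕ) (w : Word (4 + k)) → FullyCommutative w →
    ((x y z : Word (4 + k)) → HasRedExpr w (x ++ s₃ ∷ y ++ s₃ ∷ z) →
      NotOcc 3 y → NotOcc 4 y → countOcc 2 y ≡ 1)
    × ((x y z : Word (4 + k)) → NotOcc 3 y → NotOcc 4 y →
      ¬ HasRedExpr w (x ++ (s₁ ∷ s₂ ∷ []) ++ y ++ (s₃ ∷ s₂ ∷ s₁ ∷ s₃ ∷ []) ++ z))
    × ((x y z : Word (4 + k)) → NotOcc 4 y → NotOcc 5 y →
      ¬ HasRedExpr w (x ++ (s₄ ∷ s₃ ∷ []) ++ y ++ (s₂ ∷ s₃ ∷ s₂ ∷ s₄ ∷ []) ++ z))
    × ((x y z : Word (4 + k)) → NotOcc 3 y → NotOcc 4 y →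
      ¬ HasRedExpr w (x ++ (s₃ ∷ s₁ ∷ s₂ ∷ s₃ ∷ []) ++ y ++ (s₂ ∷ s₁ ∷ []) ++ z))
    × ((x y z : Word (4 + k)) → NotOcc 4 y → NotOcc 5 y →
      ¬ HasRedExpr w (x ++ (s₄ ∷ s₂ ∷ s₃ ∷ s₂ ∷ []) ++ y ++ (s₃ ∷ s₄ ∷ []) ++ z))
lemma4p3p3 k w fc =
  (λ x y z e ¬3 ¬4 → count₂-between-s₃ y ¬3 ¬4 (factor x (s₃ ∷ []) y (s₃ ∷ []) z e)) ,
  (λ x y z ¬3 ¬4 e → ¬FCWord-s₁s₂ys₃s₂s₁s₃ y ¬3 ¬4
     (factor x (s₁ ∷ s₂ ∷ []) y (s₃ ∷ s₂ ∷ s₁ ∷ s₃ ∷ []) z e)) ,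
  (λ x y z ¬4 _ e → ¬FCWord-s₃ys₂s₃s₂ y ¬4
     (FCWord-infix (s₄ ∷ []) (s₃ ∷ []) y (s₂ ∷ s₃ ∷ s₂ ∷ []) (s₄ ∷ [])
       (factor x (s₄ ∷ s₃ ∷ []) y (s₂ ∷ s₃ ∷ s₂ ∷ s₄ ∷ []) z e))) ,
  (λ x y z ¬3 ¬4 e → ¬FCWord-s₃s₁s₂s₃ys₂s₁ y ¬3 ¬4
     (factor x (s₃ ∷ s₁ ∷ s₂ ∷ s₃ ∷ []) y (s₂ ∷ s₁ ∷ []) z e)) ,
  (λ x y z ¬4 _ e → ¬FCWord-s₂s₃s₂ys₃ y ¬4
     (FCWord-infix (s₄ ∷ []) (s₂ ∷ s₃ ∷ s₂ ∷ []) y (s₃ ∷ []) (s₄ ∷ [])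
       (factor x (s₄ ∷ s₂ ∷ s₃ ∷ s₂ ∷ []) y (s₃ ∷ s₄ ∷ []) z e)))
  where
  factor : ∀ x A y Q z → HasRedExpr w (x ++ A ++ y ++ Q ++ z) → FCWord (A ++ y ++ Q)
  factor x A y Q z e = FCWord-infix x A y Q z (FCWord-redExpr fc e)
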